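{- For generalized wheel graphs with $n \geq 4$, $\mathrm{nim}(\mathrm{DNG}(W_{m,n}))=1$.
   Context: For $m\ge 2$ and $n\ge 3$, the generalized wheel graph $W_{m,n}$ is the join $\overline{K}_m+C_n$ of an edgeless graph on $m$ vertices with a cycle on $n$ vertices. For a graph $G=(V,E)$, a set of vertices is geodetically convex if it contains every vertex on every shortest path between two of its vertices; the convex hull $[P]$ is the smallest convex set containing $P$, and $P$ is generating if $[P]=V$. In the avoidance game $\mathrm{DNG}(G)$, two players alternately select previously-unselected vertices such that the selected set never generates; the player who cannot move loses. $\mathrm{nim}$ denotes the nim-number of an impartial game. -}

module Defs where

open import Data.Nat using (ℕ; zero; suc; _+_; _≤_; _<_)
open import Data.Fin using (Fin; toℕ; splitAt)
open import Data.Fin.Subset using (Subset; _∈_; _∉_; _∪_; ⁅_⁆; ⊥)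
open import Data.Sum using (_⊎_; inj₁; inj₂)
open import Data.Product using (_×_; ∃-syntax)
open import Data.Unit using (⊤)
open import Data.Empty renaming (⊥ to Empty)
open import Relation.Nullary using (¬_)
open import Relation.Binary.PropositionalEquality using (_≡_)

Graph : ℕ → Set₁
Graph N = Fin N → Fin N → Set

data Walk {N : ℕ} (G : Graph N) : Fin N → Fin N → ℕ → Set where
  here : ∀ {u} → Walk G u u 0
  step : ∀ {u w v k} → G u w → Walk G w v k → Walk G u v (suc k)

data OnWalk {N : ℕ} {G : Graph N} (x : Fin N) : ∀ {u v k} → Walk G u v k → Set where
  on-here  : OnWalk x (here {u = x})
  on-start : ∀ {w v k} (e : G x w) (p : Walk G w v k) → OnWalk x (step e p)
  on-later : ∀ {u w v k} (e : G u w) (p : Walk G w v k) → OnWalk x p → OnWalk x (step e p)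

-- A shortest (u,v)-path: a walk of length d such that every (u,v)-walk has length ≥ d
-- (a shortest walk is automatically a path).
IsShortest : ∀ {N} (G : Graph N) {u v d} → Walk G u v d → Set
IsShortest {N} G {u} {v} {d} _ = ∀ k → Walk G u v k → d ≤ k

Convex : ∀ {N} → Graph N → Subset N → Set
Convex {N} G C = ∀ u v → u ∈ C → v ∈ C → ∀ d (p : Walk G u v d) → IsShortest G p →
                 ∀ x → OnWalk x p → x ∈ C

-- P is generating: its convex hull (the smallest convex superset, i.e. the
-- intersection of all convex supersets) is all of V.
Generating : ∀ {N} → Graph N → Subset N → Set
Generating {N} G P = ∀ (C : Subset N) → Convex G C → (∀ x → x ∈ P → x ∈ C) → ∀ x → x ∈ C

LegalMove : ∀ {N} → Graph N → Subset N → Fin N → Set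
LegalMove G P v = v ∉ P × ¬ Generating G (P ∪ ⁅ v ⁆)

-- Sprague–Grundy (nim) number of position P of DNG(G), with fuel k ≥ number of
-- unselected vertices (each move selects one new vertex, so fuel N suffices from ∅).
-- NimIs k G P g : the nim-number of position P is g (mex of option values).
NimIs : ∀ {N} → ℕ → Graph N → Subset N → ℕ → Set
NimIs zero    G P g = g ≡ 0
NimIs (suc k) G P g =
  (∀ h → h < g → ∃[ v ] (LegalMove G P v × NimIs k G (P ∪ ⁅ v ⁆) h)) ×
  (∀ v → LegalMove G P v → ¬ NimIs k G (P ∪ ⁅ v ⁆) g)

nimDNG : ∀ {N} → Graph N → ℕ → Set
nimDNG {N} G g = NimIs N G ⊥ g

CycAdj : (n : ℕ) → Fin n → Fin n → Set
CycAdj n i j = (suc (toℕ i) ≡ toℕ j) ⊎ (suc (toℕ j) ≡ toℕ i)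
             ⊎ ((toℕ i ≡ 0) × (suc (toℕ j) ≡ n)) ⊎ ((toℕ j ≡ 0) × (suc (toℕ i) ≡ n))

-- Generalized wheel W_{m,n} = complement(K_m) + C_n on Fin (m + n):
-- the first m vertices form the independent set, the last n the cycle.
wheelAdj : (m n : ℕ) → Fin m ⊎ Fin n → Fin m ⊎ Fin n → Set
wheelAdj m n (inj₁ _) (inj₁ _) = Empty
wheelAdj m n (inj₁ _) (inj₂ _) = ⊤
wheelAdj m n (inj₂ _) (inj₁ _) = ⊤
wheelAdj m n (inj₂ i) (inj₂ j) = CycAdj n i j

W : (m n : ℕ) → Graph (m + n)
W m n x y = wheelAdj m n (splitAt m x) (splitAt m y)

-- In W_{m,n} (m ≥ 2, n ≥ 4) two distinct non-adjacent vertices generate: two hubs (vertices of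
-- the independent part) have every rim vertex as a common neighbour, and then two non-adjacent
-- rim vertices have every hub as a common neighbour (symmetrically when starting from the rim). Cliques are convex, so the
-- non-generating sets are exactly the cliques and DNG builds a clique one vertex at a time.
-- As C_n is triangle-free the wheel is K₄-free, while every vertex lies on an edge and every
-- edge on a triangle; so every play lasts exactly three moves and the nim-number is 1.

module Submission where

open import Defs
open import Data.Nat using (ℕ; zero; suc; _+_; _≤_; _<_; z≤n; s≤s)
import Data.Nat as ℕ
open import Data.Nat.Properties using (<-cmp; ≤-trans; m≤n+m)
open import Data.Fin using (Fin; toℕ; inject₁; _↑ˡ_; _↑ʳ_; join; splitAt) renaming (zero to fzero; suc to fsuc)
open import Data.Fin.Properties using (_≟_; toℕ-inject₁; ↑ʳ-injective; splitAt-↑ˡ; splitAt-↑ʳ; join-splitAt)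
open import Data.Fin.Subset using (Subset; _∈_; _∪_; ⁅_⁆; ⊥)
open import Data.Fin.Subset.Properties using (∉⊥; x∈⁅x⁆; x∈⁅y⁆⇒x≡y; x∈p∪q⁻; x∈p∪q⁺)
open import Data.Sum using (_⊎_; inj₁; inj₂; [_,_]′)
open import Data.Product using (_×_; _,_; ∃-syntax)
open import Data.Unit using (tt)
open import Data.Empty using (⊥-elim) renaming (⊥ to Empty)
open import Function using (id)
open import Relation.Nullary using (¬_; Dec; yes; no)
open import Relation.Nullary.Decidable using (_⊎-dec_; _×-dec_)
open import Relation.Binary using (Symmetric; Decidable; tri<; tri≈; tri>)
open import Relation.Binary.PropositionalEquality using (_≡_; _≢_; refl; sym; trans; cong; subst; subst₂)

-- Cycles

Step : ℕ → ℕ → Set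
Step i j = suc i ≡ j ⊎ suc j ≡ i

Wrap : ℕ → ℕ → ℕ → Set
Wrap n i j = (i ≡ 0 × suc j ≡ n) ⊎ (j ≡ 0 × suc i ≡ n)

CycAdjℕ : ℕ → ℕ → ℕ → Set
CycAdjℕ n i j = Step i j ⊎ Wrap n i j

TwoApart : ℕ → ℕ → Set
TwoApart i j = suc (suc i) ≡ j ⊎ suc (suc j) ≡ i

cycAdj⇒cycAdjℕ : ∀ {n} {i j : Fin n} → CycAdj n i j → CycAdjℕ n (toℕ i) (toℕ j)
cycAdj⇒cycAdjℕ (inj₁ e)        = inj₁ (inj₁ e)
cycAdj⇒cycAdjℕ (inj₂ (inj₁ e)) = inj₁ (inj₂ e)
cycAdj⇒cycAdjℕ (inj₂ (inj₂ w)) = inj₂ w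

step-sym : ∀ {i j} → Step i j → Step j i
step-sym (inj₁ e) = inj₂ e
step-sym (inj₂ e) = inj₁ e

wrap-sym : ∀ {n i j} → Wrap n i j → Wrap n j i
wrap-sym (inj₁ w) = inj₂ w
wrap-sym (inj₂ w) = inj₁ w

cycAdjℕ-irrefl : ∀ {n i} → 2 ≤ n → ¬ CycAdjℕ n i i
cycAdjℕ-irrefl _ (inj₁ (inj₁ ()))
cycAdjℕ-irrefl _ (inj₁ (inj₂ ()))
cycAdjℕ-irrefl (s≤s ()) (inj₂ (inj₁ (refl , refl)))
cycAdjℕ-irrefl (s≤s ()) (inj₂ (inj₂ (refl , refl)))

step-step : ∀ {i j k} → Step i j → Step j k → i ≡ k ⊎ TwoApart i k
step-step (inj₁ refl) (inj₁ refl) = inj₂ (inj₁ refl)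
step-step (inj₁ refl) (inj₂ refl) = inj₁ refl
step-step (inj₂ refl) (inj₁ refl) = inj₁ refl
step-step (inj₂ refl) (inj₂ refl) = inj₂ (inj₂ refl)

wrap-wrap : ∀ {n i j k} → Wrap n i j → Wrap n j k → i ≡ k
wrap-wrap (inj₁ (refl , refl)) (inj₁ (refl , refl)) = refl
wrap-wrap (inj₁ (refl , _))    (inj₂ (refl , _))    = refl
wrap-wrap (inj₂ (refl , refl)) (inj₁ (refl , refl)) = refl
wrap-wrap (inj₂ (refl , refl)) (inj₂ (refl , refl)) = refl

twoApart-¬cycAdjℕ : ∀ {n i j} → 4 ≤ n → TwoApart i j → ¬ CycAdjℕ n i j
twoApart-¬cycAdjℕ _ (inj₁ refl) (inj₁ (inj₁ ()))
twoApart-¬cycAdjℕ _ (inj₁ refl) (inj₁ (inj₂ ()))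
twoApart-¬cycAdjℕ (s≤s (s≤s (s≤s ()))) (inj₁ refl) (inj₂ (inj₁ (refl , refl)))
twoApart-¬cycAdjℕ _ (inj₁ refl) (inj₂ (inj₂ (() , _)))
twoApart-¬cycAdjℕ _ (inj₂ refl) (inj₁ (inj₁ ()))
twoApart-¬cycAdjℕ _ (inj₂ refl) (inj₁ (inj₂ ()))
twoApart-¬cycAdjℕ _ (inj₂ refl) (inj₂ (inj₁ (() , _)))
twoApart-¬cycAdjℕ (s≤s (s≤s (s≤s ()))) (inj₂ refl) (inj₂ (inj₂ (refl , refl)))

cycAdj-sym : ∀ {n} → Symmetric (CycAdj n)
cycAdj-sym (inj₁ e)        = inj₂ (inj₁ e)
cycAdj-sym (inj₂ (inj₁ e)) = inj₁ e
cycAdj-sym (inj₂ (inj₂ w)) = inj₂ (inj₂ (wrap-sym w))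

cycAdj? : ∀ n → Decidable (CycAdj n)
cycAdj? n i j = (suc (toℕ i) ℕ.≟ toℕ j) ⊎-dec (suc (toℕ j) ℕ.≟ toℕ i)
  ⊎-dec ((toℕ i ℕ.≟ 0) ×-dec (suc (toℕ j) ℕ.≟ n)) ⊎-dec ((toℕ j ℕ.≟ 0) ×-dec (suc (toℕ i) ℕ.≟ n))

cycAdj-neighbour : ∀ {k} (i : Fin (suc (suc k))) → ∃[ j ] CycAdj (suc (suc k)) i j
cycAdj-neighbour fzero    = fsuc fzero , inj₁ refl
cycAdj-neighbour (fsuc i) = inject₁ i , inj₂ (inj₁ (cong suc (toℕ-inject₁ i)))

module _ {n} (4≤n : 4 ≤ n) where

  private
    2≤n : 2 ≤ n
    2≤n = ≤-trans (s≤s (s≤s z≤n)) 4≤n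

  step-step-¬cycAdjℕ : ∀ {i j k} → Step i j → Step j k → ¬ CycAdjℕ n i k
  step-step-¬cycAdjℕ ij jk with step-step ij jk
  ... | inj₁ refl = cycAdjℕ-irrefl 2≤n
  ... | inj₂ apart = twoApart-¬cycAdjℕ 4≤n apart

  wrap-wrap-¬cycAdjℕ : ∀ {i j k} → Wrap n i j → Wrap n j k → ¬ CycAdjℕ n i k
  wrap-wrap-¬cycAdjℕ ij jk with wrap-wrap ij jk
  ... | refl = cycAdjℕ-irrefl 2≤n

  -- Two of the three edges are of the same kind, and any two edges of a triangle meet.
  cycAdjℕ-triangle-free : ∀ {i j k} → CycAdjℕ n i j → CycAdjℕ n j k → ¬ CycAdjℕ n i k
  cycAdjℕ-triangle-free (inj₁ ij) (inj₁ jk) ik       = step-step-¬cycAdjℕ ij jk ik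
  cycAdjℕ-triangle-free (inj₂ ij) (inj₂ jk) ik       = wrap-wrap-¬cycAdjℕ ij jk ik
  cycAdjℕ-triangle-free (inj₁ ij) (inj₂ jk) (inj₁ ik) = step-step-¬cycAdjℕ (step-sym ik) ij (inj₂ (wrap-sym jk))
  cycAdjℕ-triangle-free (inj₁ ij) (inj₂ jk) (inj₂ ik) = wrap-wrap-¬cycAdjℕ ik (wrap-sym jk) (inj₁ ij)
  cycAdjℕ-triangle-free (inj₂ ij) (inj₁ jk) (inj₁ ik) = step-step-¬cycAdjℕ ik (step-sym jk) (inj₂ ij)
  cycAdjℕ-triangle-free (inj₂ ij) (inj₁ jk) (inj₂ ik) = wrap-wrap-¬cycAdjℕ (wrap-sym ik) ij (inj₁ (step-sym jk))

  cycAdj-triangle-free : ∀ {i j k : Fin n} → CycAdj n i j → CycAdj n j k → ¬ CycAdj n i k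
  cycAdj-triangle-free ij jk ik =
    cycAdjℕ-triangle-free (cycAdj⇒cycAdjℕ ij) (cycAdj⇒cycAdjℕ jk) (cycAdj⇒cycAdjℕ ik)

-- Games of fixed length

parity : ℕ → ℕ
parity 0             = 0
parity 1             = 1
parity (suc (suc r)) = parity r

parity-suc-≢ : ∀ r → parity (suc r) ≢ parity r
parity-suc-≢ 0             ()
parity-suc-≢ 1             ()
parity-suc-≢ (suc (suc r)) = parity-suc-≢ r

<parity-suc⇒≡parity : ∀ r {h} → h < parity (suc r) → h ≡ parity r
<parity-suc⇒≡parity 0             (s≤s z≤n) = refl
<parity-suc⇒≡parity 1             ()
<parity-suc⇒≡parity (suc (suc r)) h<       = <parity-suc⇒≡parity r h<

module _ {N} (G : Graph N) where

  Lasts : ℕ → Subset N → Set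
  Lasts zero    P = ∀ v → ¬ LegalMove G P v
  Lasts (suc r) P = (∃[ v ] LegalMove G P v) × (∀ v → LegalMove G P v → Lasts r (P ∪ ⁅ v ⁆))

  nimIs-<⇒⊥ : ∀ {k P a b} → NimIs (suc k) G P a → NimIs (suc k) G P b → b < a → Empty
  nimIs-<⇒⊥ (options , _) (_ , exclusion) b<a with options _ b<a
  ... | v , L , nim = exclusion v L nim

  nimIs-unique : ∀ k {P g h} → NimIs k G P g → NimIs k G P h → g ≡ h
  nimIs-unique zero    g≡0 h≡0 = trans g≡0 (sym h≡0)
  nimIs-unique (suc k) {g = g} {h} nim-g nim-h with <-cmp g h
  ... | tri< g<h _ _ = ⊥-elim (nimIs-<⇒⊥ nim-h nim-g g<h)
  ... | tri≈ _ g≡h _ = g≡h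
  ... | tri> _ _ h<g = ⊥-elim (nimIs-<⇒⊥ nim-g nim-h h<g)

  lasts⇒nimIs : ∀ {k r P} → r ≤ k → Lasts r P → NimIs k G P (parity r)
  lasts⇒nimIs {zero}  {zero}  _ _ = refl
  lasts⇒nimIs {suc k} {zero}  _ stuck = (λ _ ()) , λ v L _ → stuck v L
  lasts⇒nimIs {suc k} {suc r} {P} (s≤s r≤k) ((v , L) , next) = options , exclusion
    where
      options : ∀ h → h < parity (suc r) → ∃[ w ] (LegalMove G P w × NimIs k G (P ∪ ⁅ w ⁆) h)
      options h h< rewrite <parity-suc⇒≡parity r h< = v , L , lasts⇒nimIs r≤k (next v L)

      exclusion : ∀ w → LegalMove G P w → ¬ NimIs k G (P ∪ ⁅ w ⁆) (parity (suc r))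
      exclusion w L′ nim = parity-suc-≢ r (nimIs-unique k nim (lasts⇒nimIs r≤k (next w L′)))

-- Convexity and cliques

∈∪⁅⁆⁻ : ∀ {N} {P : Subset N} {v x} → x ∈ P ∪ ⁅ v ⁆ → x ∈ P ⊎ x ≡ v
∈∪⁅⁆⁻ {P = P} {v} x∈ with x∈p∪q⁻ P ⁅ v ⁆ x∈
... | inj₁ x∈P = inj₁ x∈P
... | inj₂ x∈v = inj₂ (x∈⁅y⁆⇒x≡y v x∈v)

∈∪⁅⁆⁺ˡ : ∀ {N} {P : Subset N} {v x} → x ∈ P → x ∈ P ∪ ⁅ v ⁆
∈∪⁅⁆⁺ˡ x∈P = x∈p∪q⁺ (inj₁ x∈P)

∈∪⁅⁆⁺ʳ : ∀ {N} {P : Subset N} {v} → v ∈ P ∪ ⁅ v ⁆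
∈∪⁅⁆⁺ʳ {v = v} = x∈p∪q⁺ (inj₂ (x∈⁅x⁆ v))

Clique : ∀ {N} → Graph N → Subset N → Set
Clique G P = ∀ {x y} → x ∈ P → y ∈ P → x ≢ y → G x y

AdjacentToAll : ∀ {N} → Graph N → Subset N → Fin N → Set
AdjacentToAll G P v = ∀ {u} → u ∈ P → G u v

module _ {N} {G : Graph N} where

  onWalk-≤1 : ∀ {x u v d} (p : Walk G u v d) → d ≤ 1 → OnWalk x p → x ≡ u ⊎ x ≡ v
  onWalk-≤1 here                _        on-here                     = inj₁ refl
  onWalk-≤1 (step e p)          _        (on-start .e .p)            = inj₁ refl
  onWalk-≤1 (step e here)       _        (on-later .e .here on-here) = inj₂ refl
  onWalk-≤1 (step e (step _ _)) (s≤s ()) _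

  clique-convex : ∀ {P} → Clique G P → Convex G P
  clique-convex {P} clique u v u∈P v∈P d p shortest x x∈p =
    [ (λ { refl → u∈P }) , (λ { refl → v∈P }) ]′ (onWalk-≤1 p d≤1 x∈p)
    where
      d≤1 : d ≤ 1
      d≤1 with u ≟ v
      ... | yes refl = ≤-trans (shortest 0 here) z≤n
      ... | no u≢v   = shortest 1 (step (clique u∈P v∈P u≢v) here)

  convex-commonNeighbour : ∀ {C x y z} → Convex G C → x ∈ C → y ∈ C → x ≢ y → ¬ G x y →
                           G x z → G z y → z ∈ C
  convex-commonNeighbour {C} {x} {y} {z} convex x∈C y∈C x≢y ¬xy xz zy =
    convex x y x∈C y∈C 2 (step xz (step zy here)) shortest z (on-later xz _ (on-start zy here))
    where
      shortest : ∀ k → Walk G x y k → 2 ≤ k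
      shortest 0             here           = ⊥-elim (x≢y refl)
      shortest 1             (step xy here) = ⊥-elim (¬xy xy)
      shortest (suc (suc k)) _              = s≤s (s≤s z≤n)

module CliqueGame {N} (G : Graph N) (sym : ∀ x y → G x y → G y x) (irrefl : ∀ x → ¬ G x x)
  (G? : Decidable G)
  (nonEdge-generating : ∀ {P x y} → x ∈ P → y ∈ P → x ≢ y → ¬ G x y → Generating G P)
  {x₀ y₀ : Fin N} (x₀≢y₀ : x₀ ≢ y₀) (¬x₀y₀ : ¬ G x₀ y₀) where

  clique-¬generating : ∀ {P} → Clique G P → ¬ Generating G P
  clique-¬generating {P} clique generating = ¬x₀y₀ (clique (∈P x₀) (∈P y₀) x₀≢y₀)
    where
      ∈P : ∀ x → x ∈ P
      ∈P = generating P (clique-convex clique) (λ _ → id)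

  clique-⊥ : Clique G ⊥
  clique-⊥ x∈⊥ = ⊥-elim (∉⊥ x∈⊥)

  adjacentToAll-⊥ : ∀ {v} → AdjacentToAll G ⊥ v
  adjacentToAll-⊥ u∈⊥ = ⊥-elim (∉⊥ u∈⊥)

  adjacentToAll-∪⁅⁆ : ∀ {P u v} → AdjacentToAll G P v → G u v → AdjacentToAll G (P ∪ ⁅ u ⁆) v
  adjacentToAll-∪⁅⁆ adjacent uv x∈ with ∈∪⁅⁆⁻ x∈
  ... | inj₁ x∈P = adjacent x∈P
  ... | inj₂ refl = uv

  clique-∪⁅⁆ : ∀ {P v} → Clique G P → AdjacentToAll G P v → Clique G (P ∪ ⁅ v ⁆)
  clique-∪⁅⁆ clique adjacent x∈ y∈ x≢y with ∈∪⁅⁆⁻ x∈ | ∈∪⁅⁆⁻ y∈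
  ... | inj₁ x∈P  | inj₁ y∈P  = clique x∈P y∈P x≢y
  ... | inj₁ x∈P  | inj₂ refl = adjacent x∈P
  ... | inj₂ refl | inj₁ y∈P  = sym _ _ (adjacent y∈P)
  ... | inj₂ refl | inj₂ refl = ⊥-elim (x≢y refl)

  clique-⁅⁆ : ∀ {u} → Clique G (⊥ ∪ ⁅ u ⁆)
  clique-⁅⁆ = clique-∪⁅⁆ clique-⊥ adjacentToAll-⊥

  clique-⁅⁆∪⁅⁆ : ∀ {u v} → G u v → Clique G ((⊥ ∪ ⁅ u ⁆) ∪ ⁅ v ⁆)
  clique-⁅⁆∪⁅⁆ uv = clique-∪⁅⁆ clique-⁅⁆ (adjacentToAll-∪⁅⁆ adjacentToAll-⊥ uv)

  clique-legalMove : ∀ {P v} → Clique G P → AdjacentToAll G P v → LegalMove G P v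
  clique-legalMove clique adjacent =
    (λ v∈P → irrefl _ (adjacent v∈P)) , clique-¬generating (clique-∪⁅⁆ clique adjacent)

  legalMove⇒adjacentToAll : ∀ {P v} → LegalMove G P v → AdjacentToAll G P v
  legalMove⇒adjacentToAll {v = v} (v∉P , ¬generating) {u} u∈P with G? u v
  ... | yes uv = uv
  ... | no ¬uv = ⊥-elim (¬generating (nonEdge-generating (∈∪⁅⁆⁺ˡ u∈P) ∈∪⁅⁆⁺ʳ u≢v ¬uv))
    where
      u≢v : u ≢ v
      u≢v refl = v∉P u∈P

  module _ (K₄-free : ∀ w x y z → G w x → G w y → G w z → G x y → G x z → G y z → Empty)
           (edge-in-triangle : ∀ u v → G u v → ∃[ w ] (G u w × G v w))
           (neighbour : ∀ u → ∃[ v ] G u v) where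

    lasts-⁅⁆∪⁅⁆∪⁅⁆ : ∀ {u v w} → G u v → G u w → G v w → Lasts G 0 (((⊥ ∪ ⁅ u ⁆) ∪ ⁅ v ⁆) ∪ ⁅ w ⁆)
    lasts-⁅⁆∪⁅⁆∪⁅⁆ {u} {v} {w} uv uw vw x L =
      K₄-free u v w x uv uw (adjacent (∈∪⁅⁆⁺ˡ (∈∪⁅⁆⁺ˡ ∈∪⁅⁆⁺ʳ))) vw (adjacent (∈∪⁅⁆⁺ˡ ∈∪⁅⁆⁺ʳ)) (adjacent ∈∪⁅⁆⁺ʳ)
      where
        adjacent : AdjacentToAll G (((⊥ ∪ ⁅ u ⁆) ∪ ⁅ v ⁆) ∪ ⁅ w ⁆) x
        adjacent = legalMove⇒adjacentToAll L

    lasts-⁅⁆∪⁅⁆ : ∀ {u v} → G u v → Lasts G 1 ((⊥ ∪ ⁅ u ⁆) ∪ ⁅ v ⁆)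
    lasts-⁅⁆∪⁅⁆ {u} {v} uv with edge-in-triangle u v uv
    ... | w , uw , vw = (w , clique-legalMove (clique-⁅⁆∪⁅⁆ uv) adjacent) , λ x L →
      lasts-⁅⁆∪⁅⁆∪⁅⁆ uv (legalMove⇒adjacentToAll L (∈∪⁅⁆⁺ˡ ∈∪⁅⁆⁺ʳ)) (legalMove⇒adjacentToAll L ∈∪⁅⁆⁺ʳ)
      where
        adjacent : AdjacentToAll G ((⊥ ∪ ⁅ u ⁆) ∪ ⁅ v ⁆) w
        adjacent = adjacentToAll-∪⁅⁆ (adjacentToAll-∪⁅⁆ adjacentToAll-⊥ uw) vw

    lasts-⁅⁆ : ∀ u → Lasts G 2 (⊥ ∪ ⁅ u ⁆)
    lasts-⁅⁆ u with neighbour u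
    ... | v , uv = (v , clique-legalMove clique-⁅⁆ (adjacentToAll-∪⁅⁆ adjacentToAll-⊥ uv)) ,
                   λ x L → lasts-⁅⁆∪⁅⁆ (legalMove⇒adjacentToAll L ∈∪⁅⁆⁺ʳ)

    lasts-⊥ : Lasts G 3 ⊥
    lasts-⊥ = (x₀ , clique-legalMove clique-⊥ adjacentToAll-⊥) , λ x _ → lasts-⁅⁆ x

-- The generalized wheel

module _ {m n : ℕ} where

  wheelAdj-sym : ∀ s t → wheelAdj m n s t → wheelAdj m n t s
  wheelAdj-sym (inj₁ _) (inj₂ _) _  = tt
  wheelAdj-sym (inj₂ _) (inj₁ _) _  = tt
  wheelAdj-sym (inj₂ _) (inj₂ _) ij = cycAdj-sym ij

  wheelAdj? : ∀ s t → Dec (wheelAdj m n s t)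
  wheelAdj? (inj₁ _) (inj₁ _) = no λ ()
  wheelAdj? (inj₁ _) (inj₂ _) = yes tt
  wheelAdj? (inj₂ _) (inj₁ _) = yes tt
  wheelAdj? (inj₂ i) (inj₂ j) = cycAdj? n i j

  wheelAdj-irrefl : 2 ≤ n → ∀ s → ¬ wheelAdj m n s s
  wheelAdj-irrefl 2≤n (inj₂ _) ii = cycAdjℕ-irrefl 2≤n (cycAdj⇒cycAdjℕ ii)

  -- At most one of the four vertices is a hub, so three of them form a triangle on the rim.
  wheelAdj-K₄-free : 4 ≤ n → ∀ s t u v → wheelAdj m n s t → wheelAdj m n s u → wheelAdj m n s v →
                     wheelAdj m n t u → wheelAdj m n t v → wheelAdj m n u v → Empty
  wheelAdj-K₄-free _   (inj₁ _) (inj₁ _) _        _        () _  _  _  _  _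
  wheelAdj-K₄-free _   (inj₁ _) (inj₂ _) (inj₁ _) _        _  () _  _  _  _
  wheelAdj-K₄-free _   (inj₁ _) (inj₂ _) (inj₂ _) (inj₁ _) _  _  () _  _  _
  wheelAdj-K₄-free 4≤n (inj₁ _) (inj₂ _) (inj₂ _) (inj₂ _) _  _  _  tu tv uv = cycAdj-triangle-free 4≤n tu uv tv
  wheelAdj-K₄-free _   (inj₂ _) (inj₁ _) (inj₁ _) _        _  _  _  () _  _
  wheelAdj-K₄-free _   (inj₂ _) (inj₁ _) (inj₂ _) (inj₁ _) _  _  _  _  () _
  wheelAdj-K₄-free 4≤n (inj₂ _) (inj₁ _) (inj₂ _) (inj₂ _) _  su sv _  _  uv = cycAdj-triangle-free 4≤n su uv sv
  wheelAdj-K₄-free _   (inj₂ _) (inj₂ _) (inj₁ _) (inj₁ _) _  _  _  _  _  ()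
  wheelAdj-K₄-free 4≤n (inj₂ _) (inj₂ _) (inj₁ _) (inj₂ _) st _  sv _  tv _  = cycAdj-triangle-free 4≤n st tv sv
  wheelAdj-K₄-free 4≤n (inj₂ _) (inj₂ _) (inj₂ _) _        st su _  tu _  _  = cycAdj-triangle-free 4≤n st tu su

module Wheel (m′ n′ : ℕ) where

  m n : ℕ
  m = 2 + m′
  n = 4 + n′

  4≤n : 4 ≤ n
  4≤n = s≤s (s≤s (s≤s (s≤s z≤n)))

  G : Graph (m + n)
  G = W m n

  hub : Fin m → Fin (m + n)
  hub a = a ↑ˡ n

  rim : Fin n → Fin (m + n)
  rim i = m ↑ʳ i

  data HubOrRim : Fin (m + n) → Set where
    isHub : ∀ a → HubOrRim (hub a)
    isRim : ∀ i → HubOrRim (rim i)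

  hubOrRim : ∀ x → HubOrRim x
  hubOrRim x = subst HubOrRim (join-splitAt m n x) (fromSplit (splitAt m x))
    where
      fromSplit : ∀ s → HubOrRim (join m n s)
      fromSplit (inj₁ a) = isHub a
      fromSplit (inj₂ i) = isRim i

  hub-hub : ∀ a b → ¬ G (hub a) (hub b)
  hub-hub a b = subst₂ (wheelAdj m n) (splitAt-↑ˡ m a n) (splitAt-↑ˡ m b n)

  hub-rim : ∀ a i → G (hub a) (rim i)
  hub-rim a i = subst₂ (wheelAdj m n) (sym (splitAt-↑ˡ m a n)) (sym (splitAt-↑ʳ m n i)) tt

  rim-hub : ∀ i a → G (rim i) (hub a)
  rim-hub i a = subst₂ (wheelAdj m n) (sym (splitAt-↑ʳ m n i)) (sym (splitAt-↑ˡ m a n)) tt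

  rim-rim : ∀ i j → CycAdj n i j → G (rim i) (rim j)
  rim-rim i j = subst₂ (wheelAdj m n) (sym (splitAt-↑ʳ m n i)) (sym (splitAt-↑ʳ m n j))

  rim-rim⁻ : ∀ i j → G (rim i) (rim j) → CycAdj n i j
  rim-rim⁻ i j = subst₂ (wheelAdj m n) (splitAt-↑ʳ m n i) (splitAt-↑ʳ m n j)

  G-sym : ∀ x y → G x y → G y x
  G-sym x y = wheelAdj-sym (splitAt m x) (splitAt m y)

  G-irrefl : ∀ x → ¬ G x x
  G-irrefl x = wheelAdj-irrefl (s≤s (s≤s z≤n)) (splitAt m x)

  G? : Decidable G
  G? x y = wheelAdj? (splitAt m x) (splitAt m y)

  G-K₄-free : ∀ w x y z → G w x → G w y → G w z → G x y → G x z → G y z → Empty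
  G-K₄-free w x y z =
    wheelAdj-K₄-free 4≤n (splitAt m w) (splitAt m x) (splitAt m y) (splitAt m z)

  neighbour : ∀ u → ∃[ v ] G u v
  neighbour u with hubOrRim u
  ... | isHub a = rim fzero , hub-rim a fzero
  ... | isRim i = hub fzero , rim-hub i fzero

  edge-in-triangle : ∀ u v → G u v → ∃[ w ] (G u w × G v w)
  edge-in-triangle u v uv with hubOrRim u | hubOrRim v
  ... | isHub a | isHub b = ⊥-elim (hub-hub a b uv)
  ... | isHub a | isRim i = let j , ij = cycAdj-neighbour i in rim j , hub-rim a j , rim-rim i j ij
  ... | isRim i | isHub a = let j , ij = cycAdj-neighbour i in rim j , rim-rim i j ij , hub-rim a j
  ... | isRim i | isRim j = hub fzero , rim-hub i fzero , rim-hub j fzero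

  module _ {C : Subset (m + n)} (convex : Convex G C) where

    hull-rims : ∀ {a b} → hub a ∈ C → hub b ∈ C → hub a ≢ hub b → ∀ i → rim i ∈ C
    hull-rims {a} {b} a∈C b∈C a≢b i =
      convex-commonNeighbour convex a∈C b∈C a≢b (hub-hub a b) (hub-rim a i) (rim-hub i b)

    hull-hubs : ∀ {i j} → rim i ∈ C → rim j ∈ C → rim i ≢ rim j → ¬ G (rim i) (rim j) →
                ∀ a → hub a ∈ C
    hull-hubs {i} {j} i∈C j∈C i≢j ¬ij a =
      convex-commonNeighbour convex i∈C j∈C i≢j ¬ij (rim-hub i a) (hub-rim a j)

    hull-all : (∀ a → hub a ∈ C) → (∀ i → rim i ∈ C) → ∀ x → x ∈ C
    hull-all hubs rims x with hubOrRim x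
    ... | isHub a = hubs a
    ... | isRim i = rims i

  hub₀≢hub₁ : hub fzero ≢ hub (fsuc fzero)
  hub₀≢hub₁ ()

  rim₀≢rim₂ : rim fzero ≢ rim (fsuc (fsuc fzero))
  rim₀≢rim₂ e with ↑ʳ-injective m fzero (fsuc (fsuc fzero)) e
  ... | ()

  ¬rim₀rim₂ : ¬ G (rim fzero) (rim (fsuc (fsuc fzero)))
  ¬rim₀rim₂ e = twoApart-¬cycAdjℕ 4≤n (inj₁ refl) (cycAdj⇒cycAdjℕ (rim-rim⁻ _ _ e))

  nonEdge-generating : ∀ {P x y} → x ∈ P → y ∈ P → x ≢ y → ¬ G x y → Generating G P
  nonEdge-generating {x = x} {y} x∈P y∈P x≢y ¬xy C convex P⊆C with hubOrRim x | hubOrRim y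
  ... | isHub a | isHub b = hull-all convex (hull-hubs convex (rims _) (rims _) rim₀≢rim₂ ¬rim₀rim₂) rims
    where
      rims : ∀ i → rim i ∈ C
      rims = hull-rims convex (P⊆C _ x∈P) (P⊆C _ y∈P) x≢y
  ... | isRim i | isRim j = hull-all convex hubs (hull-rims convex (hubs _) (hubs _) hub₀≢hub₁)
    where
      hubs : ∀ a → hub a ∈ C
      hubs = hull-hubs convex (P⊆C _ x∈P) (P⊆C _ y∈P) x≢y ¬xy
  ... | isHub a | isRim i = ⊥-elim (¬xy (hub-rim a i))
  ... | isRim i | isHub a = ⊥-elim (¬xy (rim-hub i a))

  open CliqueGame G G-sym G-irrefl G? nonEdge-generating hub₀≢hub₁ (hub-hub fzero (fsuc fzero))

  lasts-∅ : Lasts G 3 ⊥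
  lasts-∅ = lasts-⊥ G-K₄-free edge-in-triangle neighbour

proposition7p28 : ∀ (m n : ℕ) → 2 ≤ m → 4 ≤ n → nimDNG (W m n) 1
proposition7p28 (suc (suc m′)) (suc (suc (suc (suc n′)))) (s≤s (s≤s _)) (s≤s (s≤s (s≤s (s≤s _)))) =
  lasts⇒nimIs (W (2 + m′) (4 + n′)) 3≤m+n (Wheel.lasts-∅ m′ n′)
  where
    3≤m+n : 3 ≤ (2 + m′) + (4 + n′)
    3≤m+n = ≤-trans (s≤s (s≤s (s≤s z≤n))) (m≤n+m (4 + n′) (2 + m′))
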